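{- Let $G=(V,E)$ be a 3-regular planar multigraph and let $G_a=(V\cup\{a\},E\cup\{va:v\in V\})$. Assign the signature $[0,0,0,1,0]$ to each vertex of $V$ and the signature $[1,0,1,0,\dots,1]$ of arity $|V|$ to $a$. Then the Holant value $Z(G_a)$ equals the number of matchings of $G$.
   Context: A symmetric signature $[f_0,\dots,f_k]$ of arity $k$ is the function $\{0,1\}^k\to\mathbb{C}$ whose value on an input of Hamming weight $i$ is $f_i$; so $[0,0,0,1,0]$ is $1$ exactly on inputs of weight 3, and $[1,0,1,0,\dots,1]$ is $1$ exactly on inputs of even weight. For a graph whose vertices are assigned signatures of arity equal to their degree (inputs indexed by incident edges), $Z=\sum_{\sigma:\text{edges}\to\{0,1\}}\prod_v f_v(\sigma|_{E(v)})$. A matching is a set of pairwise vertex-disjoint edges (the empty set included). -}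

module Defs where

open import Data.Nat using (ℕ; zero; suc; _+_; _*_; _≤ᵇ_; _≡ᵇ_)
open import Data.Nat.Base using (_%_)
open import Data.Bool using (Bool; true; false; not; if_then_else_; _∧_; _∨_)
open import Data.Fin using (Fin; toℕ) renaming (zero to fzero; suc to fsuc)
open import Data.Fin.Properties using (_≟_)
open import Data.Nat.ListAction using (sum; product)
open import Data.List using (List; []; _∷_; map; concatMap; allFin; upTo; length; filter; foldr)
open import Data.Product using (_×_; _,_; proj₁; proj₂; ∃; ∃-syntax)
open import Relation.Nullary.Decidable using (does)
open import Relation.Binary.PropositionalEquality using (_≡_)

allAssign : (k : ℕ) → List (Fin k → Bool)
allAssign zero = (λ ()) ∷ []
allAssign (suc k) =
  concatMap (λ b → map (λ f → λ { fzero → b ; (fsuc i) → f i }) (allAssign k))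
            (true ∷ false ∷ [])

count : {A : Set} → List A → (A → Bool) → ℕ
count xs p = length (filter (λ x → Data.Bool._≟_ (p x) true) xs)

allB : {A : Set} → List A → (A → Bool) → Bool
allB xs p = foldr (λ x r → p x ∧ r) true xs

anyB : {A : Set} → List A → (A → Bool) → Bool
anyB xs p = foldr (λ x r → p x ∨ r) false xs

iter : {A : Set} → (A → A) → ℕ → A → A
iter f zero x = x
iter f (suc k) x = f (iter f k x)

b2n : Bool → ℕ
b2n true = 1
b2n false = 0

-- Multigraphs: vertex set Fin n, edge set Fin m, edge e has endpoints ends e.
-- Parallel edges and loops are allowed.

Ends : ℕ → ℕ → Set
Ends n m = Fin m → Fin n × Fin n

-- number of endpoints of edge e equal to v (0, 1 or 2 for a loop)
mult : ∀ {n m} → Ends n m → Fin n → Fin m → ℕ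
mult ends v e = b2n (does (proj₁ (ends e) ≟ v)) + b2n (does (proj₂ (ends e) ≟ v))

degree : ∀ {n m} → Ends n m → Fin n → ℕ
degree {m = m} ends v = sum (map (mult ends v) (allFin m))

Cubic : ∀ {n m} → Ends n m → Set
Cubic {n} ends = (v : Fin n) → degree ends v ≡ 3

-- Planarity, via combinatorial embeddings (rotation systems):
-- a multigraph is planar iff it has a rotation system whose face count
-- satisfies Euler's formula  |V| - |E| + |F| = 2 · (#components).

Dart : ℕ → Set
Dart m = Fin m × Bool

tail : ∀ {n m} → Ends n m → Dart m → Fin n
tail ends (e , false) = proj₁ (ends e)
tail ends (e , true)  = proj₂ (ends e)

flip : ∀ {m} → Dart m → Dart m
flip (e , b) = (e , not b)

allDarts : (m : ℕ) → List (Dart m)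
allDarts m = concatMap (λ e → (e , false) ∷ (e , true) ∷ []) (allFin m)

code : ∀ {m} → Dart m → ℕ
code (e , b) = 2 * toℕ e + b2n b

record RotationSystem {n m : ℕ} (ends : Ends n m) : Set where
  field
    ρ      : Dart m → Dart m
    ρ⁻¹    : Dart m → Dart m
    inv₁   : ∀ d → ρ (ρ⁻¹ d) ≡ d
    inv₂   : ∀ d → ρ⁻¹ (ρ d) ≡ d
    local  : ∀ d → tail ends (ρ d) ≡ tail ends d
    cyclic : ∀ d d' → tail ends d ≡ tail ends d' → ∃[ k ] iter ρ k d ≡ d'

-- number of orbits of a permutation π on the darts
-- (counted by orbit representatives of minimal code; orbits have size ≤ 2m)
orbitCount : ∀ m → (Dart m → Dart m) → ℕ
orbitCount m π =
  count (allDarts m) (λ d → allB (upTo (2 * m)) (λ k → code d ≤ᵇ code (iter π k d)))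

faces : ∀ {n m} {ends : Ends n m} → RotationSystem ends → ℕ
faces {m = m} R = orbitCount m (λ d → RotationSystem.ρ R (flip d))

adjB : ∀ {n m} → Ends n m → Fin n → Fin n → Bool
adjB {m = m} ends v w = anyB (allFin m) (λ e →
  (does (proj₁ (ends e) ≟ v) ∧ does (proj₂ (ends e) ≟ w)) ∨
  (does (proj₂ (ends e) ≟ v) ∧ does (proj₁ (ends e) ≟ w)))

reach : ∀ {n m} → Ends n m → ℕ → Fin n → Fin n → Bool
reach ends zero v w = does (v ≟ w)
reach {n} ends (suc k) v w =
  reach ends k v w ∨ anyB (allFin n) (λ u → reach ends k v u ∧ adjB ends u w)

-- number of connected components (representative = least reachable vertex)
components : ∀ {n m} → Ends n m → ℕ
components {n} ends =
  count (allFin n) (λ v → allB (allFin n) (λ w →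
    not (reach ends n w v) ∨ (toℕ v ≤ᵇ toℕ w)))

Planar : ∀ {n m} → Ends n m → Set
Planar {n} {m} ends =
  ∃[ R ] (n + faces {ends = ends} R ≡ m + 2 * components ends)

-- Symmetric signatures [f₀,…,f_k], evaluated at a Hamming weight.

evalSym : List ℕ → ℕ → ℕ
evalSym []       _       = 0
evalSym (f ∷ fs) zero    = f
evalSym (f ∷ fs) (suc i) = evalSym fs i

vertexSig : List ℕ
vertexSig = 0 ∷ 0 ∷ 0 ∷ 1 ∷ 0 ∷ []

parSig : ℕ → List ℕ
parSig k = map (λ i → if i % 2 ≡ᵇ 0 then 1 else 0) (upTo (suc k))

-- Holant value of G_a: G plus an apex a joined to every vertex by one edge.
-- σ assigns the edges of G, τ assigns the edge va for each v ∈ V.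

weightAt : ∀ {n m} → Ends n m → (Fin m → Bool) → (Fin n → Bool) → Fin n → ℕ
weightAt {m = m} ends σ τ v =
  sum (map (λ e → if σ e then mult ends v e else 0) (allFin m)) + b2n (τ v)

holantApex : ∀ {n m} → Ends n m → ℕ
holantApex {n} {m} ends =
  sum (map (λ σ → sum (map (λ τ →
        product (map (λ v → evalSym vertexSig (weightAt ends σ τ v)) (allFin n))
        * evalSym (parSig n) (sum (map (λ v → b2n (τ v)) (allFin n))))
      (allAssign n))) (allAssign m))

-- Matchings: edge sets M in which every vertex is covered at most once
-- (so the edges are pairwise vertex-disjoint; loops can never occur).

isMatching : ∀ {n m} → Ends n m → (Fin m → Bool) → Bool
isMatching {n} {m} ends M = allB (allFin n) (λ v →
  sum (map (λ e → if M e then mult ends v e else 0) (allFin m)) ≤ᵇ 1)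

numMatchings : ∀ {n m} → Ends n m → ℕ
numMatchings {m = m} ends = count (allAssign m) (isMatching ends)

{-# OPTIONS --safe #-}
module Submission where

-- Fix the values σ of the edges of G. A vertex v then sees weight s(v) + τ(v),
-- where s(v) counts its σ-edges and τ(v) ∈ {0,1} is the value of its apex edge;
-- by cubicity s(v) = 3 − t(v), where t(v) is the degree of v in M = σ⁻¹(0).
-- The signature [0,0,0,1,0] forces τ(v) = t(v) ≤ 1, so for each σ exactly one τ
-- can contribute, and it contributes precisely when M is a matching. The apex
-- then has weight Σ t(v) = 2|M|, which is even, so its signature gives 1. Hence
-- Z(G_a) counts the σ whose zero set is a matching, i.e. the matchings of G.

open import Algebra.Properties.CommutativeSemigroup using (interchange)
open import Data.Bool using (Bool; true; false; not; if_then_else_; _∧_)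
open import Data.Bool.Properties using (not-¬; ∧-conicalˡ; ∧-conicalʳ; T-≡)
open import Data.Empty using (⊥-elim)
open import Data.Fin using (Fin) renaming (zero to fzero; suc to fsuc)
open import Data.Fin.Properties using (_≟_)
open import Data.List using (List; []; _∷_; _++_; map; allFin; applyUpTo; length)
open import Data.List.Membership.Propositional using (_∈_)
open import Data.List.Membership.Propositional.Properties using (∈-map⁺; ∈-allFin)
open import Data.List.Properties
  using (map-cong; map-∘; map-++; map-tabulate; length-tabulate; ++-identityʳ)
open import Data.List.Relation.Unary.Any using (here; there)
open import Data.Nat using (ℕ; zero; suc; _+_; _*_; _≤_; _<_; z≤n; s≤s; _≤ᵇ_; _≡ᵇ_)
open import Data.Nat.Divisibility using (0∣⇒≡0)
open import Data.Nat.DivMod using (m*n%n≡0)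
open import Data.Nat.ListAction using (sum; product)
open import Data.Nat.ListAction.Properties using (sum-++; ∈⇒∣product)
open import Data.Nat.Properties
  using (+-identityʳ; +-comm; *-distribʳ-+; ≤ᵇ⇒≤; m≤n⇒m≤1+n; +-commutativeSemigroup)
open import Data.Product using (proj₁; proj₂)
import Data.Vec.Functional as V
open import Data.Vec.Functional.Properties using (∷-cong)
open import Defs
open import Function using (_∘_; id)
open import Function.Bundles using (Equivalence)
open import Relation.Binary.Core using (_Preserves_⟶_)
open import Relation.Binary.PropositionalEquality
  using (_≡_; _≢_; _≗_; refl; sym; trans; cong; cong₂; subst; ≢-sym; module ≡-Reasoning)
open import Relation.Nullary.Decidable using (does)

open ≡-Reasoning

∑ : {A : Set} → List A → (A → ℕ) → ℕ
∑ xs f = sum (map f xs)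

syntax ∑ xs (λ x → e) = ∑[ x ∈ xs ] e

private variable A B : Set

∑-cong : (xs : List A) {f g : A → ℕ} → f ≗ g → ∑ xs f ≡ ∑ xs g
∑-cong xs f≗g = cong sum (map-cong f≗g xs)

∑-zero : (xs : List A) {f : A → ℕ} → (∀ x → f x ≡ 0) → ∑ xs f ≡ 0
∑-zero []       f≡0 = refl
∑-zero (x ∷ xs) f≡0 = cong₂ _+_ (f≡0 x) (∑-zero xs f≡0)

∑-++ : (xs ys : List A) {f : A → ℕ} → ∑ (xs ++ ys) f ≡ ∑ xs f + ∑ ys f
∑-++ xs ys {f} = trans (cong sum (map-++ f xs ys)) (sum-++ (map f xs) (map f ys))

∑-map : (g : B → A) (xs : List B) {f : A → ℕ} → ∑ (map g xs) f ≡ ∑ xs (f ∘ g)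
∑-map g xs = cong sum (sym (map-∘ xs))

∑-distrib-+ : (xs : List A) {f g : A → ℕ} → ∑[ x ∈ xs ] (f x + g x) ≡ ∑ xs f + ∑ xs g
∑-distrib-+ []       = refl
∑-distrib-+ (x ∷ xs) {f} {g} =
  trans (cong (f x + g x +_) (∑-distrib-+ xs))
        (interchange +-commutativeSemigroup (f x) (g x) (∑ xs f) (∑ xs g))

*-distribʳ-∑ : (xs : List A) {f : A → ℕ} (c : ℕ) → ∑ xs f * c ≡ ∑[ x ∈ xs ] (f x * c)
*-distribʳ-∑ []           c = refl
*-distribʳ-∑ (x ∷ xs) {f} c =
  trans (*-distribʳ-+ c (f x) (∑ xs f)) (cong (f x * c +_) (*-distribʳ-∑ xs c))

∑-comm : (xs : List A) (ys : List B) (f : A → B → ℕ) →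
  ∑[ x ∈ xs ] ∑[ y ∈ ys ] f x y ≡ ∑[ y ∈ ys ] ∑[ x ∈ xs ] f x y
∑-comm []       ys f = sym (∑-zero ys (λ _ → refl))
∑-comm (x ∷ xs) ys f =
  trans (cong (∑ ys (f x) +_) (∑-comm xs ys f)) (sym (∑-distrib-+ ys))

∑-b2n≤length : (xs : List A) (p : A → Bool) → ∑[ x ∈ xs ] b2n (p x) ≤ length xs
∑-b2n≤length []       p = z≤n
∑-b2n≤length (x ∷ xs) p with p x
... | true  = s≤s (∑-b2n≤length xs p)
... | false = m≤n⇒m≤1+n (∑-b2n≤length xs p)

count≡∑ : (xs : List A) (p : A → Bool) → count xs p ≡ ∑[ x ∈ xs ] b2n (p x)
count≡∑ []       p = refl
count≡∑ (x ∷ xs) p with p x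
... | true  = cong suc (count≡∑ xs p)
... | false = count≡∑ xs p

allB-cong : (xs : List A) {p q : A → Bool} → p ≗ q → allB xs p ≡ allB xs q
allB-cong []       p≗q = refl
allB-cong (x ∷ xs) p≗q = cong₂ _∧_ (p≗q x) (allB-cong xs p≗q)

allB-true : {xs : List A} (p : A → Bool) → allB xs p ≡ true → ∀ {x} → x ∈ xs → p x ≡ true
allB-true {xs = y ∷ ys} p all (here refl)  = ∧-conicalˡ (p y) _ all
allB-true {xs = y ∷ ys} p all (there x∈ys) = allB-true p (∧-conicalʳ (p y) _ all) x∈ys

product-b2n : (xs : List A) (p : A → Bool) → product (map (λ x → b2n (p x)) xs) ≡ b2n (allB xs p)
product-b2n []       p = refl
product-b2n (x ∷ xs) p with p x
... | true  = trans (+-identityʳ _) (product-b2n xs p)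
... | false = refl

product-map-≡0 : {xs : List A} (f : A → ℕ) {x : A} → x ∈ xs → f x ≡ 0 → product (map f xs) ≡ 0
product-map-≡0 {xs = xs} f x∈xs fx≡0 =
  0∣⇒≡0 (∈⇒∣product (subst (_∈ map f xs) fx≡0 (∈-map⁺ f x∈xs)))

b2n*n≡b2n : {n : ℕ} (b : Bool) → (b ≡ true → n ≡ 1) → b2n b * n ≡ b2n b
b2n*n≡b2n true  n≡1 = trans (+-identityʳ _) (n≡1 refl)
b2n*n≡b2n false _   = refl

∑-allFin-suc : ∀ {n} (f : Fin (suc n) → ℕ) →
  ∑ (allFin (suc n)) f ≡ f fzero + ∑ (allFin n) (f ∘ fsuc)
∑-allFin-suc f = cong (λ xs → f fzero + sum xs)
  (trans (map-tabulate fsuc f) (sym (map-tabulate id (f ∘ fsuc))))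

∑-indicator : ∀ {n} (x : Fin n) → ∑[ v ∈ allFin n ] b2n (does (x ≟ v)) ≡ 1
∑-indicator {suc n} fzero =
  trans (∑-allFin-suc {n} (λ v → b2n (does (fzero ≟ v))))
        (cong suc (∑-zero (allFin n) (λ _ → refl)))
∑-indicator {suc n} (fsuc x) =
  trans (∑-allFin-suc {n} (λ v → b2n (does (fsuc x ≟ v)))) (∑-indicator x)

∑-b2n≤n : ∀ {n} (p : Fin n → Bool) → ∑[ v ∈ allFin n ] b2n (p v) ≤ n
∑-b2n≤n {n} p =
  subst (∑[ v ∈ allFin n ] b2n (p v) ≤_) (length-tabulate id) (∑-b2n≤length (allFin n) p)

evalSym-map-applyUpTo : ∀ {k} (g h : ℕ → ℕ) {w} → w < k →
  evalSym (map g (applyUpTo h k)) w ≡ g (h w)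
evalSym-map-applyUpTo g h {zero}  (s≤s _)   = refl
evalSym-map-applyUpTo g h {suc w} (s≤s w<k) = evalSym-map-applyUpTo g (h ∘ suc) w<k

evalSym-parSig-even : ∀ {n} k → k * 2 ≤ n → evalSym (parSig n) (k * 2) ≡ 1
evalSym-parSig-even k k*2≤n =
  trans (evalSym-map-applyUpTo _ id (s≤s k*2≤n))
        (cong (λ r → if r ≡ᵇ 0 then 1 else 0) (m*n%n≡0 k 2))

∘∷-preserves-≗ : ∀ {k} {F : (Fin (suc k) → Bool) → ℕ} → F Preserves _≗_ ⟶ _≡_ →
  ∀ b → (F ∘ (b V.∷_)) Preserves _≗_ ⟶ _≡_
∘∷-preserves-≗ F-ext b σ≗σ′ = F-ext (∷-cong refl σ≗σ′)

∑-allAssign-suc : ∀ {k} (F : (Fin (suc k) → Bool) → ℕ) → F Preserves _≗_ ⟶ _≡_ → (b : Bool) →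
  ∑ (allAssign (suc k)) F ≡ ∑ (allAssign k) (F ∘ (b V.∷_)) + ∑ (allAssign k) (F ∘ (not b V.∷_))
∑-allAssign-suc {k} F F-ext true = ∑-halves (λ _ → F-ext (∷-cong refl λ _ → refl))
                                            (λ _ → F-ext (∷-cong refl λ _ → refl))
  where
  σs : List (Fin k → Bool)
  σs = allAssign k
  -- allAssign (suc k) unfolds to this shape for the two anonymous extension maps of
  -- Defs; they are not definitionally true ∷_ and false ∷_, only pointwise equal.
  ∑-halves : {g₁ g₀ : (Fin k → Bool) → Fin (suc k) → Bool} →
    (∀ σ → F (g₁ σ) ≡ F (true V.∷ σ)) → (∀ σ → F (g₀ σ) ≡ F (false V.∷ σ)) →
    ∑ (map g₁ σs ++ map g₀ σs ++ []) F ≡ ∑ σs (F ∘ (true V.∷_)) + ∑ σs (F ∘ (false V.∷_))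
  ∑-halves {g₁} {g₀} g₁≈ g₀≈ = begin
    ∑ (map g₁ σs ++ map g₀ σs ++ []) F
      ≡⟨ cong (λ ys → ∑ (map g₁ σs ++ ys) F) (++-identityʳ (map g₀ σs)) ⟩
    ∑ (map g₁ σs ++ map g₀ σs) F
      ≡⟨ ∑-++ (map g₁ σs) (map g₀ σs) ⟩
    ∑ (map g₁ σs) F + ∑ (map g₀ σs) F
      ≡⟨ cong₂ _+_ (trans (∑-map g₁ σs) (∑-cong σs g₁≈)) (trans (∑-map g₀ σs) (∑-cong σs g₀≈)) ⟩
    ∑ σs (F ∘ (true V.∷_)) + ∑ σs (F ∘ (false V.∷_)) ∎
∑-allAssign-suc {k} F F-ext false =
  trans (∑-allAssign-suc F F-ext true) (+-comm (∑ (allAssign k) (F ∘ (true V.∷_))) _)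

∑-allAssign-point : ∀ {k} (F : (Fin k → Bool) → ℕ) → F Preserves _≗_ ⟶ _≡_ →
  (τ₀ : Fin k → Bool) → (∀ τ i → τ i ≢ τ₀ i → F τ ≡ 0) → ∑ (allAssign k) F ≡ F τ₀
∑-allAssign-point {zero}  F F-ext τ₀ _     = trans (+-identityʳ _) (F-ext λ ())
∑-allAssign-point {suc k} F F-ext τ₀ F-off = begin
  ∑ (allAssign (suc k)) F                       ≡⟨ ∑-allAssign-suc F F-ext b ⟩
  ∑ σs (F ∘ (b V.∷_)) + ∑ σs (F ∘ (not b V.∷_)) ≡⟨ cong₂ _+_ on-τ₀ off-τ₀ ⟩
  F (b V.∷ V.tail τ₀) + 0                       ≡⟨ +-identityʳ _ ⟩
  F (b V.∷ V.tail τ₀)                           ≡⟨ F-ext (∷-cong refl λ _ → refl) ⟩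
  F τ₀                                          ∎
  where
  σs : List (Fin k → Bool)
  σs = allAssign k
  b : Bool
  b = V.head τ₀
  on-τ₀ : ∑ σs (F ∘ (b V.∷_)) ≡ F (b V.∷ V.tail τ₀)
  on-τ₀ = ∑-allAssign-point (F ∘ (b V.∷_)) (∘∷-preserves-≗ F-ext b) (V.tail τ₀)
            (λ τ i → F-off (b V.∷ τ) (fsuc i))
  off-τ₀ : ∑ σs (F ∘ (not b V.∷_)) ≡ 0
  off-τ₀ = ∑-zero σs (λ τ → F-off (not b V.∷ τ) fzero (≢-sym (not-¬ refl)))

∑-allAssign-complement : ∀ {k} (F : (Fin k → Bool) → ℕ) → F Preserves _≗_ ⟶ _≡_ →
  ∑ (allAssign k) F ≡ ∑ (allAssign k) (F ∘ V.map not)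
∑-allAssign-complement {zero}  F F-ext = cong (_+ 0) (F-ext λ ())
∑-allAssign-complement {suc k} F F-ext = begin
  ∑ (allAssign (suc k)) F
    ≡⟨ ∑-allAssign-suc F F-ext true ⟩
  ∑ σs (F ∘ (true V.∷_)) + ∑ σs (F ∘ (false V.∷_))
    ≡⟨ cong₂ _+_ (∑-allAssign-complement (F ∘ (true V.∷_)) (∘∷-preserves-≗ F-ext true))
                 (∑-allAssign-complement (F ∘ (false V.∷_)) (∘∷-preserves-≗ F-ext false)) ⟩
  ∑[ σ ∈ σs ] F (true V.∷ V.map not σ) + ∑[ σ ∈ σs ] F (false V.∷ V.map not σ)
    ≡⟨ cong₂ _+_ (∑-cong σs λ _ → F-ext (∷-cong refl λ _ → refl))
                 (∑-cong σs λ _ → F-ext (∷-cong refl λ _ → refl)) ⟩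
  ∑[ σ ∈ σs ] F (V.map not (false V.∷ σ)) + ∑[ σ ∈ σs ] F (V.map not (true V.∷ σ))
    ≡⟨ ∑-allAssign-suc (F ∘ V.map not) (λ σ≗σ′ → F-ext (cong not ∘ σ≗σ′)) false ⟨
  ∑ (allAssign (suc k)) (F ∘ V.map not) ∎
  where
  σs : List (Fin k → Bool)
  σs = allAssign k

vertexSig-off : ∀ t s → t + s ≡ 3 → ∀ {c} → c ≢ (t ≡ᵇ 1) → evalSym vertexSig (s + b2n c) ≡ 0
vertexSig-off 0 _ refl {true}  _   = refl
vertexSig-off 0 _ refl {false} c≢  = ⊥-elim (c≢ refl)
vertexSig-off 1 _ refl {true}  c≢  = ⊥-elim (c≢ refl)
vertexSig-off 1 _ refl {false} _   = refl
vertexSig-off 2 _ refl {true}  _   = refl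
vertexSig-off 2 _ refl {false} _   = refl
vertexSig-off 3 _ refl {true}  _   = refl
vertexSig-off 3 _ refl {false} _   = refl

vertexSig-on : ∀ t s → t + s ≡ 3 → evalSym vertexSig (s + b2n (t ≡ᵇ 1)) ≡ b2n (t ≤ᵇ 1)
vertexSig-on 0 _ refl = refl
vertexSig-on 1 _ refl = refl
vertexSig-on 2 _ refl = refl
vertexSig-on 3 _ refl = refl

b2n-≡ᵇ1 : ∀ {t} → t ≤ 1 → b2n (t ≡ᵇ 1) ≡ t
b2n-≡ᵇ1 z≤n       = refl
b2n-≡ᵇ1 (s≤s z≤n) = refl

size : ∀ {m} → (Fin m → Bool) → ℕ
size {m} M = ∑[ e ∈ allFin m ] b2n (M e)

module _ {n m : ℕ} (ends : Ends n m) where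

  degreeIn : (Fin m → Bool) → Fin n → ℕ
  degreeIn M v = ∑[ e ∈ allFin m ] (if M e then mult ends v e else 0)

  covered : (Fin m → Bool) → Fin n → Bool
  covered M v = degreeIn M v ≡ᵇ 1

  degreeIn-cong : ∀ {M M′} → M ≗ M′ → ∀ v → degreeIn M v ≡ degreeIn M′ v
  degreeIn-cong M≗M′ v =
    ∑-cong (allFin m) λ e → cong (λ b → if b then mult ends v e else 0) (M≗M′ e)

  degreeIn-complement : ∀ σ v → degreeIn (V.map not σ) v + degreeIn σ v ≡ degree ends v
  degreeIn-complement σ v = trans (sym (∑-distrib-+ (allFin m))) (∑-cong (allFin m) per-edge)
    where
    per-edge : ∀ e → (if not (σ e) then mult ends v e else 0) + (if σ e then mult ends v e else 0)
                     ≡ mult ends v e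
    per-edge e with σ e
    ... | true  = refl
    ... | false = +-identityʳ _

  ∑-mult≡2 : ∀ e → ∑[ v ∈ allFin n ] mult ends v e ≡ 2
  ∑-mult≡2 e = trans (∑-distrib-+ (allFin n))
                     (cong₂ _+_ (∑-indicator (proj₁ (ends e))) (∑-indicator (proj₂ (ends e))))

  handshake : ∀ M → ∑[ v ∈ allFin n ] degreeIn M v ≡ size M * 2
  handshake M = begin
    ∑[ v ∈ allFin n ] degreeIn M v
      ≡⟨ ∑-comm (allFin n) (allFin m) _ ⟩
    ∑[ e ∈ allFin m ] ∑[ v ∈ allFin n ] (if M e then mult ends v e else 0)
      ≡⟨ ∑-cong (allFin m) edge-ends ⟩
    ∑[ e ∈ allFin m ] (b2n (M e) * 2)
      ≡⟨ *-distribʳ-∑ (allFin m) 2 ⟨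
    size M * 2 ∎
    where
    edge-ends : ∀ e → ∑[ v ∈ allFin n ] (if M e then mult ends v e else 0) ≡ b2n (M e) * 2
    edge-ends e with M e
    ... | true  = ∑-mult≡2 e
    ... | false = ∑-zero (allFin n) λ _ → refl

  isMatching-cong : ∀ {M M′} → M ≗ M′ → isMatching ends M ≡ isMatching ends M′
  isMatching-cong M≗M′ = allB-cong (allFin n) λ v → cong (_≤ᵇ 1) (degreeIn-cong M≗M′ v)

  isMatching⇒degreeIn≤1 : ∀ {M} → isMatching ends M ≡ true → ∀ v → degreeIn M v ≤ 1
  isMatching⇒degreeIn≤1 {M} matching v =
    ≤ᵇ⇒≤ _ 1 (Equivalence.from T-≡ (allB-true (λ v → degreeIn M v ≤ᵇ 1) matching (∈-allFin v)))

  ∑-covered≡size*2 : ∀ {M} → isMatching ends M ≡ true →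
    ∑[ v ∈ allFin n ] b2n (covered M v) ≡ size M * 2
  ∑-covered≡size*2 {M} matching =
    trans (∑-cong (allFin n) λ v → b2n-≡ᵇ1 (isMatching⇒degreeIn≤1 matching v)) (handshake M)

  parSig-covered : ∀ {M} → isMatching ends M ≡ true →
    evalSym (parSig n) (∑[ v ∈ allFin n ] b2n (covered M v)) ≡ 1
  parSig-covered {M} matching =
    trans (cong (evalSym (parSig n)) even) (evalSym-parSig-even (size M) (subst (_≤ n) even bound))
    where
    even : ∑[ v ∈ allFin n ] b2n (covered M v) ≡ size M * 2
    even = ∑-covered≡size*2 matching
    bound : ∑[ v ∈ allFin n ] b2n (covered M v) ≤ n
    bound = ∑-b2n≤n (covered M)

  vertexWeights : (Fin m → Bool) → (Fin n → Bool) → ℕ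
  vertexWeights σ τ = product (map (λ v → evalSym vertexSig (weightAt ends σ τ v)) (allFin n))

  apexWeight : (Fin n → Bool) → ℕ
  apexWeight τ = evalSym (parSig n) (∑[ v ∈ allFin n ] b2n (τ v))

  apexTerm : (Fin m → Bool) → (Fin n → Bool) → ℕ
  apexTerm σ τ = vertexWeights σ τ * apexWeight τ

  apexTerm-cong : ∀ σ → apexTerm σ Preserves _≗_ ⟶ _≡_
  apexTerm-cong σ τ≗τ′ = cong₂ _*_
    (cong product (map-cong (λ v → cong (λ c → evalSym vertexSig (degreeIn σ v + b2n c)) (τ≗τ′ v))
                            (allFin n)))
    (cong (evalSym (parSig n)) (∑-cong (allFin n) (cong b2n ∘ τ≗τ′)))

  module _ (cubic : Cubic ends) (σ : Fin m → Bool) where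
    private
      M : Fin m → Bool
      M = V.map not σ

    degreeIn-zeros+degreeIn≡3 : ∀ v → degreeIn M v + degreeIn σ v ≡ 3
    degreeIn-zeros+degreeIn≡3 v = trans (degreeIn-complement σ v) (cubic v)

    apexTerm-off : ∀ τ v → τ v ≢ covered M v → apexTerm σ τ ≡ 0
    apexTerm-off τ v τv≢ = cong (_* apexWeight τ)
      (product-map-≡0 (λ v → evalSym vertexSig (weightAt ends σ τ v)) (∈-allFin v)
        (vertexSig-off (degreeIn M v) (degreeIn σ v) (degreeIn-zeros+degreeIn≡3 v) τv≢))

    vertexWeights-covered : vertexWeights σ (covered M) ≡ b2n (isMatching ends M)
    vertexWeights-covered = begin
      vertexWeights σ (covered M)
        ≡⟨ cong product (map-cong vertex (allFin n)) ⟩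
      product (map (λ v → b2n (degreeIn M v ≤ᵇ 1)) (allFin n))
        ≡⟨ product-b2n (allFin n) (λ v → degreeIn M v ≤ᵇ 1) ⟩
      b2n (isMatching ends M) ∎
      where
      vertex : ∀ v → evalSym vertexSig (weightAt ends σ (covered M) v) ≡ b2n (degreeIn M v ≤ᵇ 1)
      vertex v = vertexSig-on (degreeIn M v) (degreeIn σ v) (degreeIn-zeros+degreeIn≡3 v)

    ∑-apexTerm : ∑ (allAssign n) (apexTerm σ) ≡ b2n (isMatching ends M)
    ∑-apexTerm = begin
      ∑ (allAssign n) (apexTerm σ)
        ≡⟨ ∑-allAssign-point (apexTerm σ) (apexTerm-cong σ) (covered M) apexTerm-off ⟩
      vertexWeights σ (covered M) * apexWeight (covered M)
        ≡⟨ cong (_* apexWeight (covered M)) vertexWeights-covered ⟩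
      b2n (isMatching ends M) * apexWeight (covered M)
        ≡⟨ b2n*n≡b2n (isMatching ends M) (parSig-covered {M}) ⟩
      b2n (isMatching ends M) ∎

lemma7p4 : (n m : ℕ) (ends : Ends n m) → Cubic ends → Planar ends →
    holantApex ends ≡ numMatchings ends
lemma7p4 n m ends cubic _ = begin
  holantApex ends
    ≡⟨ ∑-cong (allAssign m) (∑-apexTerm ends cubic) ⟩
  ∑[ σ ∈ allAssign m ] b2n (isMatching ends (V.map not σ))
    ≡⟨ ∑-allAssign-complement _ (cong b2n ∘ isMatching-cong ends) ⟨
  ∑[ σ ∈ allAssign m ] b2n (isMatching ends σ)
    ≡⟨ count≡∑ (allAssign m) (isMatching ends) ⟨
  numMatchings ends ∎
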